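{- Rule 1 is safe. That is: let $(\tilde G,\tilde S,\tilde k)$ be a tuple to which Rule 1 applies and let $(G',S',k')$ be the resulting tuple; if $G'\setminus S'$ has a spanning subgraph $H'\in\Pi$ with at least $pt(G'\setminus S')+k'$ edges, then $\tilde G\setminus\tilde S$ has a spanning subgraph $\tilde H\in\Pi$ with at least $pt(\tilde G\setminus\tilde S)+\tilde k$ edges.
   Context: Fix $0<\lambda<1$, $\lambda'=\frac{1-\lambda}{2}$, and a strongly $\lambda$-extendible property $\Pi$ of graphs (graphs are finite, loopless, without multiple edges, possibly with oriented and/or labelled edges; connectivity, cliques, blocks, cut vertices refer to the underlying simple graph; a block is a maximal connected subgraph without a cut vertex). $\Pi$ is strongly $\lambda$-extendible if: every graph whose underlying simple graph is $K_1$ or $K_2$ is in $\Pi$; a graph is in $\Pi$ iff each of its blocks is in $\Pi$; and for every graph $G$, $S\subseteq V(G)$ with $G[S],G\setminus S\in\Pi$ and every $c:E(G)\to\mathbb{R}^+$ there is $F\subseteq\delta(S)$ with $c(F)\ge\lambda c(\delta(S))$ such that deleting the edges $\delta(S)\setminus F$ from $G$ yields a graph in $\Pi$ (here $\delta(S)$ is the set of edges with exactly one endpoint in $S$, $G[S]$ the induced subgraph, $G\setminus S=G[V(G)\setminus S]$). The empty graph is assumed to be in $\Pi$. For a graph $G$, $pt(G)=\lambda|E(G)|+\lambda'(|V(G)|-1)$. A tuple is $(\tilde G,\tilde S,\tilde k)$ with $\tilde G$ a graph, $\tilde S\subseteq V(\tilde G)$, $\tilde k$ a real number. Rule 1: Let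 $\tilde G\setminus\tilde S$ be connected. If $v\in V(\tilde G)\setminus\tilde S$ and $X\subseteq V(\tilde G)\setminus(\tilde S\cup\{v\})$ are such that $\tilde G[X]$ is a connected component of $\tilde G\setminus(\tilde S\cup\{v\})$ and $X\cup\{v\}$ is a clique in $\tilde G$, then delete $X$ from $\tilde G$ to obtain $G'$, and set $S'=\tilde S$, $k'=\tilde k$.
   Formalization: The parameter λ and the tuple entry $\tilde k$ take values in ℚ instead of the reals. -}

module Defs where

open import Data.Nat using (ℕ; zero; suc; _≡ᵇ_)
open import Data.Integer using (+_)
open import Data.Rational using (ℚ; _/_; _+_; _*_; _-_; _≤_; _<_; 0ℚ; 1ℚ; ½)
open import Data.Bool using (Bool; true; false; not; _∧_; _∨_; _xor_; if_then_else_)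
open import Data.Maybe using (Maybe; just; nothing; is-just)
open import Data.List using (List; []; _∷_; length; filterᵇ; concatMap; map; foldr)
open import Data.List.Membership.Propositional using (_∈_)
open import Data.List.Relation.Unary.Unique.Propositional using (Unique)
open import Data.Product using (Σ; _×_; _,_; ∃)
open import Data.Sum using (_⊎_)
open import Relation.Binary.PropositionalEquality using (_≡_; _≢_)
open import Relation.Nullary using (¬_)
open import Function.Bundles using (_⇔_)

-- A graph consists of a finite
-- vertex list and an arc function: adj u v ≡ just ℓ means there is an
-- edge between u and v, oriented from u to v, carrying label ℓ : L.
-- (Unoriented graphs are represented by ignoring the orientation, i.e.
-- by properties Π that do not look at it.)

record Graph (L : Set) : Set where
  constructor mkGraph
  field
    V   : List ℕ
    adj : ℕ → ℕ → Maybe L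
open Graph public

module _ {L : Set} where

  record WF (G : Graph L) : Set where
    field
      V-unique : Unique (V G)
      adj-V    : ∀ u v ℓ → adj G u v ≡ just ℓ → u ∈ V G × v ∈ V G × u ≢ v
      adj-simple : ∀ u v ℓ → adj G u v ≡ just ℓ → adj G v u ≡ nothing

  SameGraph : Graph L → Graph L → Set
  SameGraph G H = (∀ x → (x ∈ V G → x ∈ V H) × (x ∈ V H → x ∈ V G))
                × (∀ u v → adj G u v ≡ adj H u v)

  edges : Graph L → List (ℕ × ℕ)
  edges G = concatMap (λ u → concatMap (λ v →
              if is-just (adj G u v) then (u , v) ∷ [] else []) (V G)) (V G)

  ∣E∣ : Graph L → ℕ
  ∣E∣ G = length (edges G)

  ∣V∣ : Graph L → ℕ
  ∣V∣ G = length (V G)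

  induced : Graph L → (ℕ → Bool) → Graph L
  induced G P = mkGraph (filterᵇ P (V G))
                        (λ u v → if P u ∧ P v then adj G u v else nothing)

  _∖_ : Graph L → (ℕ → Bool) → Graph L
  G ∖ P = induced G (λ x → not (P x))

  spanning : Graph L → (ℕ → ℕ → Bool) → Graph L
  spanning G keep = mkGraph (V G) (λ u v → if keep u v then adj G u v else nothing)

  crosses : (ℕ → Bool) → ℕ → ℕ → Bool
  crosses S u v = S u xor S v

  cutEdges : Graph L → (ℕ → Bool) → List (ℕ × ℕ)
  cutEdges G S = filterᵇ (λ { (u , v) → crosses S u v }) (edges G)

  keptCutEdges : Graph L → (ℕ → Bool) → (ℕ → ℕ → Bool) → List (ℕ × ℕ)
  keptCutEdges G S keep = filterᵇ (λ { (u , v) → keep u v }) (cutEdges G S)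

  deleteCutExcept : Graph L → (ℕ → Bool) → (ℕ → ℕ → Bool) → Graph L
  deleteCutExcept G S keep =
    mkGraph (V G) (λ u v → if crosses S u v ∧ not (keep u v) then nothing else adj G u v)

  cost : (ℕ → ℕ → ℚ) → List (ℕ × ℕ) → ℚ
  cost c es = foldr (λ { (u , v) r → c u v + r }) 0ℚ es

  IsJust : Maybe L → Set
  IsJust m = is-just m ≡ true

  Adj : Graph L → ℕ → ℕ → Set
  Adj G u w = IsJust (adj G u w) ⊎ IsJust (adj G w u)

  data Reach (G : Graph L) : ℕ → ℕ → Set where
    here : ∀ {u} → Reach G u u
    step : ∀ {u w v} → Adj G u w → Reach G w v → Reach G u v

  Connected : Graph L → Set
  Connected G = ∀ u v → u ∈ V G → v ∈ V G → Reach G u v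

  _⊆ᵥ_[_] : (ℕ → Bool) → (ℕ → Bool) → Graph L → Set
  P ⊆ᵥ Q [ G ] = ∀ x → x ∈ V G → P x ≡ true → Q x ≡ true

  NonEmptyIn : Graph L → (ℕ → Bool) → Set
  NonEmptyIn G P = Σ ℕ λ x → x ∈ V G × P x ≡ true

  HasCutVertex : Graph L → Set
  HasCutVertex H = Σ ℕ λ x → x ∈ V H × ¬ Connected (H ∖ (λ y → y ≡ᵇ x))

  -- B (a vertex set) spans a block of G: a maximal connected subgraph
  -- without a cut vertex (maximal subgraphs with this property are induced)
  BlockCand : Graph L → (ℕ → Bool) → Set
  BlockCand G B = NonEmptyIn G B × Connected (induced G B) × ¬ HasCutVertex (induced G B)

  IsBlock : Graph L → (ℕ → Bool) → Set
  IsBlock G B = BlockCand G B × (∀ B' → B ⊆ᵥ B' [ G ] → BlockCand G B' → B' ⊆ᵥ B [ G ])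

  IsComponent : Graph L → (ℕ → Bool) → Set
  IsComponent G X = NonEmptyIn G X × Connected (induced G X)
                  × (∀ Y → X ⊆ᵥ Y [ G ] → Connected (induced G Y) → Y ⊆ᵥ X [ G ])

  IsClique : Graph L → (ℕ → Bool) → Set
  IsClique G P = ∀ a b → a ∈ V G → b ∈ V G → P a ≡ true → P b ≡ true → a ≢ b → Adj G a b

  IsK1orK2 : Graph L → Set
  IsK1orK2 G = (∣V∣ G ≡ 1 × ∣E∣ G ≡ 0) ⊎ (∣V∣ G ≡ 2 × ∣E∣ G ≡ 1)

ℕ→ℚ : ℕ → ℚ
ℕ→ℚ n = + n / 1

lam' : ℚ → ℚ
lam' lam = ½ * (1ℚ - lam)

pt : {L : Set} → ℚ → Graph L → ℚ
pt lam G = lam * ℕ→ℚ (∣E∣ G) + lam' lam * (ℕ→ℚ (∣V∣ G) - 1ℚ)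

record StronglyExtendible {L : Set} (lam : ℚ) (Π : Graph L → Set) : Set₁ where
  field
    respects : ∀ (G H : Graph L) → WF G → SameGraph G H → Π G → Π H
    empty    : Π (mkGraph [] (λ _ _ → nothing))
    K1K2     : ∀ (G : Graph L) → WF G → IsK1orK2 G → Π G
    blocks   : ∀ (G : Graph L) → WF G → Π G ⇔ (∀ B → IsBlock G B → Π (induced G B))
    extend   : ∀ (G : Graph L) → WF G → (S : ℕ → Bool) → Π (induced G S) → Π (G ∖ S) →
               (c : ℕ → ℕ → ℚ) →
               (∀ u v → u ∈ V G → v ∈ V G → IsJust (adj G u v) → 0ℚ < c u v) →
               Σ (ℕ → ℕ → Bool) λ keep →
                 (lam * cost {L = L} c (cutEdges G S) ≤ cost {L = L} c (keptCutEdges G S keep))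
                 × Π (deleteCutExcept G S keep)

GoodSpanning : {L : Set} → ℚ → (Graph L → Set) → Graph L → ℚ → Set
GoodSpanning lam Π G k =
  Σ (ℕ → ℕ → Bool) λ keep → Π (spanning G keep) × (pt lam G + k ≤ ℕ→ℚ (∣E∣ (spanning G keep)))

Rule1Applies : {L : Set} → Graph L → (ℕ → Bool) → ℕ → (ℕ → Bool) → Set
Rule1Applies G S v X =
  Connected (G ∖ S) × v ∈ V G × S v ≡ false
  × (X ⊆ᵥ (λ x → not (S x ∨ (x ≡ᵇ v))) [ G ])
  × (∀ x → X x ≡ true → x ∈ V G)
  × IsComponent (G ∖ (λ x → S x ∨ (x ≡ᵇ v))) X
  × IsClique G (λ x → X x ∨ (x ≡ᵇ v))

{-# OPTIONS --safe #-}
module Submission where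

-- Add the vertices of X back to G′ ∖ S′ two at a time.  Each pair is a K₂ (X ∪ {v} is a
-- clique), so λ-extendibility with unit costs across the cut between the pair and the
-- rest keeps the pair's edge and at least λ d of its d cut edges, while pt only grows by
-- λ (1 + d) + 2 λ′ = 1 + λ d.  If |X| is odd, one vertex x is added first, alone: X is a
-- component of G ∖ (S ∪ {v}), so at that moment v is the only neighbour of x, pt grows by
-- λ + λ′ = (1 + λ)/2 ≤ 1, and keeping a positive fraction of one edge means keeping it.

open import Defs
open import Data.Nat using (ℕ; zero; suc; _≡ᵇ_; _+_; _≟_)
open import Data.Nat.Properties using (≡ᵇ⇒≡; +-identityʳ; +-assoc; +-comm; +-suc; +-commutativeSemigroup)
open import Algebra.Properties.CommutativeSemigroup +-commutativeSemigroup
  using () renaming (interchange to +-interchange)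
open import Data.Bool using (Bool; true; false; not; _∧_; _∨_; _xor_; if_then_else_)
open import Data.Bool.Properties using (T-≡; ∨-assoc; ∨-comm; ∨-zeroʳ; ∧-zeroʳ; ∧-identityʳ; not-¬)
open import Data.Maybe using (Maybe; just; nothing; is-just)
open import Data.List using (List; []; _∷_; length; filterᵇ; concatMap; foldr; _++_)
open import Data.List.Properties using (length-++; concatMap-cong; filter-++)
open import Data.List.Membership.Propositional using (_∈_)
open import Data.List.Membership.Propositional.Properties using (∈-filter⁺; ∈-filter⁻)
open import Data.List.Membership.DecPropositional _≟_ using (_∈?_)
open import Data.List.Relation.Unary.Any using (here; there)
open import Data.List.Relation.Unary.All using (All; []; _∷_; lookup)
import Data.List.Relation.Unary.All as All
open import Data.List.Relation.Unary.Unique.Propositional using (Unique)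
import Data.List.Relation.Unary.Unique.Propositional.Properties as Unique
open import Data.List.Relation.Unary.AllPairs using ([]; _∷_)
open import Data.Product using (Σ; _×_; _,_; proj₁; proj₂)
import Data.Product as Product
open import Data.Sum using (_⊎_; inj₁; inj₂)
open import Data.Empty using (⊥; ⊥-elim)
import Data.Integer as ℤ
import Data.Integer.Properties as ℤₚ
open import Data.Nat.Coprimality using (1-coprimeTo) renaming (sym to coprime-sym)
open import Data.Rational using (ℚ; mkℚ; _<_; _≤_; 0ℚ; 1ℚ; ½)
import Data.Rational as ℚ
import Data.Rational.Properties as ℚₚ
open import Data.Rational.Solver using (module +-*-Solver)
open import Algebra.Bundles using (CommutativeMonoid)
open import Algebra.Properties.CommutativeSemigroup
  (CommutativeMonoid.commutativeSemigroup ℚₚ.+-0-commutativeMonoid) using (xy∙z≈xz∙y)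
open import Function using (_∘_; id)
open import Function.Bundles using (Equivalence)
open import Relation.Binary.PropositionalEquality
  using (_≡_; _≢_; refl; sym; trans; cong; cong₂; subst; subst₂; module ≡-Reasoning)
open import Relation.Nullary using (does; yes; no)
open import Relation.Nullary.Decidable using (dec-true; dec-false; T?)

≡ᵇ-refl : ∀ n → (n ≡ᵇ n) ≡ true
≡ᵇ-refl zero    = refl
≡ᵇ-refl (suc n) = ≡ᵇ-refl n

≡ᵇ-true⇒≡ : ∀ {m n} → (m ≡ᵇ n) ≡ true → m ≡ n
≡ᵇ-true⇒≡ {m} {n} e = ≡ᵇ⇒≡ m n (Equivalence.from T-≡ e)

≢⇒≡ᵇ-false : ∀ {m n} → m ≢ n → (m ≡ᵇ n) ≡ false
≢⇒≡ᵇ-false {m} {n} m≢n with m ≡ᵇ n in e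
... | true  = ⊥-elim (m≢n (≡ᵇ-true⇒≡ e))
... | false = refl

≡ᵇ-false⇒≢ : ∀ {m n} → (m ≡ᵇ n) ≡ false → m ≢ n
≡ᵇ-false⇒≢ {m} e refl with () ← trans (sym e) (≡ᵇ-refl m)

not-true⇒false : ∀ {b} → not b ≡ true → b ≡ false
not-true⇒false {false} _ = refl

not-∨-true : ∀ a b → not (a ∨ b) ≡ true → a ≡ false × b ≡ false
not-∨-true false false _ = refl , refl

module _ {A : Set} (P : A → Bool) where

  ∈-filterᵇ⁺ : ∀ {x xs} → x ∈ xs → P x ≡ true → x ∈ filterᵇ P xs
  ∈-filterᵇ⁺ x∈xs Px = ∈-filter⁺ (T? ∘ P) x∈xs (Equivalence.from T-≡ Px)

  ∈-filterᵇ⁻ : ∀ {x xs} → x ∈ filterᵇ P xs → x ∈ xs × P x ≡ true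
  ∈-filterᵇ⁻ x∈ = Product.map₂ (Equivalence.to T-≡) (∈-filter⁻ (T? ∘ P) x∈)

  Unique-filterᵇ : ∀ {xs} → Unique xs → Unique (filterᵇ P xs)
  Unique-filterᵇ = Unique.filter⁺ (T? ∘ P)

  filterᵇ-true : (∀ x → P x ≡ true) → ∀ xs → filterᵇ P xs ≡ xs
  filterᵇ-true all [] = refl
  filterᵇ-true all (x ∷ xs) with P x | all x
  ... | true | _ = cong (x ∷_) (filterᵇ-true all xs)

  length-filterᵇ-split : ∀ xs → length xs ≡ length (filterᵇ (not ∘ P) xs) + length (filterᵇ P xs)
  length-filterᵇ-split [] = refl
  length-filterᵇ-split (x ∷ xs) with P x
  ... | true  = trans (cong suc (length-filterᵇ-split xs)) (sym (+-suc _ _))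
  ... | false = cong suc (length-filterᵇ-split xs)

module _ {A : Set} where

  filterᵇ-cong : ∀ {P Q : A → Bool} → (∀ x → P x ≡ Q x) → ∀ xs → filterᵇ P xs ≡ filterᵇ Q xs
  filterᵇ-cong {P} {Q} P≗Q [] = refl
  filterᵇ-cong {P} {Q} P≗Q (x ∷ xs) with P x | Q x | P≗Q x
  ... | true  | true  | _ = cong (x ∷_) (filterᵇ-cong P≗Q xs)
  ... | false | false | _ = filterᵇ-cong P≗Q xs

  filterᵇ-filterᵇ : ∀ (P Q : A → Bool) xs → filterᵇ P (filterᵇ Q xs) ≡ filterᵇ (λ x → Q x ∧ P x) xs
  filterᵇ-filterᵇ P Q [] = refl
  filterᵇ-filterᵇ P Q (x ∷ xs) with Q x
  ... | false = filterᵇ-filterᵇ P Q xs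
  ... | true with P x
  ...   | true  = cong (x ∷_) (filterᵇ-filterᵇ P Q xs)
  ...   | false = filterᵇ-filterᵇ P Q xs

_∈ᵇ_ : ℕ → List ℕ → Bool
x ∈ᵇ xs = does (x ∈? xs)

pairᵇ : ℕ → ℕ → ℕ → Bool
pairᵇ a b x = (x ≡ᵇ a) ∨ (x ≡ᵇ b)

∉⇒∈ᵇ-false : ∀ {x xs} → All (x ≢_) xs → x ∈ᵇ xs ≡ false
∉⇒∈ᵇ-false {x} {xs} x∉ = dec-false (x ∈? xs) (λ x∈ → lookup x∉ x∈ refl)

∑ : List ℕ → (ℕ → ℕ) → ℕ
∑ xs f = foldr (λ x s → f x + s) 0 xs

[_] : Bool → ℕ
[ b ] = if b then 1 else 0

∑-cong : ∀ xs {f g : ℕ → ℕ} → (∀ x → x ∈ xs → f x ≡ g x) → ∑ xs f ≡ ∑ xs g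
∑-cong []       f≗g = refl
∑-cong (y ∷ xs) f≗g = cong₂ _+_ (f≗g y (here refl)) (∑-cong xs (λ x x∈ → f≗g x (there x∈)))

∑-+ : ∀ xs (f g : ℕ → ℕ) → ∑ xs (λ x → f x + g x) ≡ ∑ xs f + ∑ xs g
∑-+ []       f g = refl
∑-+ (y ∷ xs) f g = trans (cong ((f y + g y) +_) (∑-+ xs f g)) (+-interchange (f y) (g y) _ _)

∑-+₃ : ∀ xs (f g h : ℕ → ℕ) → ∑ xs (λ x → f x + g x + h x) ≡ ∑ xs f + ∑ xs g + ∑ xs h
∑-+₃ xs f g h = trans (∑-+ xs (λ x → f x + g x) h) (cong (_+ ∑ xs h) (∑-+ xs f g))

∑-zero : ∀ xs {f : ℕ → ℕ} → (∀ x → x ∈ xs → f x ≡ 0) → ∑ xs f ≡ 0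
∑-zero xs f≗0 = trans (∑-cong xs f≗0) (∑-0 xs)
  where
  ∑-0 : ∀ xs → ∑ xs (λ _ → 0) ≡ 0
  ∑-0 []       = refl
  ∑-0 (_ ∷ xs) = ∑-0 xs

∑-filterᵇ : ∀ (P : ℕ → Bool) xs f → ∑ (filterᵇ P xs) f ≡ ∑ xs (λ x → if P x then f x else 0)
∑-filterᵇ P []       f = refl
∑-filterᵇ P (y ∷ xs) f with P y
... | true  = cong (f y +_) (∑-filterᵇ P xs f)
... | false = ∑-filterᵇ P xs f

∑-one : ∀ xs f {a} → Unique xs → a ∈ xs → (∀ x → x ∈ xs → x ≢ a → f x ≡ 0) → ∑ xs f ≡ f a
∑-one (y ∷ xs) f (y∉ ∷ _) (here refl) off =
  trans (cong (f y +_) (∑-zero xs (λ x x∈ → off x (there x∈) (λ x≡y → lookup y∉ x∈ (sym x≡y)))))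
        (+-identityʳ (f y))
∑-one (y ∷ xs) f (y∉ ∷ u) (there a∈) off
  rewrite off y (here refl) (lookup y∉ a∈) = ∑-one xs f u a∈ (λ x x∈ → off x (there x∈))

∑-two : ∀ xs f {a b} → Unique xs → a ∈ xs → b ∈ xs → a ≢ b →
        (∀ x → x ∈ xs → x ≢ a → x ≢ b → f x ≡ 0) → ∑ xs f ≡ f a + f b
∑-two (y ∷ xs) f (y∉ ∷ u) (here refl) (here refl) a≢b off = ⊥-elim (a≢b refl)
∑-two (y ∷ xs) f (y∉ ∷ u) (here refl) (there b∈) a≢b off =
  cong (f y +_) (∑-one xs f u b∈ (λ x x∈ → off x (there x∈) (λ x≡y → lookup y∉ x∈ (sym x≡y))))
∑-two (y ∷ xs) f (y∉ ∷ u) (there a∈) (here refl) a≢b off =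
  trans (cong (f y +_)
          (∑-one xs f u a∈ (λ x x∈ x≢a → off x (there x∈) x≢a (λ x≡y → lookup y∉ x∈ (sym x≡y)))))
        (+-comm (f y) _)
∑-two (y ∷ xs) f (y∉ ∷ u) (there a∈) (there b∈) a≢b off
  rewrite off y (here refl) (lookup y∉ a∈) (lookup y∉ b∈) =
    ∑-two xs f u a∈ b∈ a≢b (λ x x∈ → off x (there x∈))

length-filterᵇ : ∀ (P : ℕ → Bool) xs → length (filterᵇ P xs) ≡ ∑ xs (λ x → [ P x ])
length-filterᵇ P []       = refl
length-filterᵇ P (y ∷ xs) with P y
... | true  = cong suc (length-filterᵇ P xs)
... | false = length-filterᵇ P xs

pairsFrom : (ℕ → ℕ → Bool) → ℕ → List ℕ → List (ℕ × ℕ)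
pairsFrom e u vs = concatMap (λ v → if e u v then (u , v) ∷ [] else []) vs

-- edges G unfolds to pairsWhere (V G) (arcᵇ G)
pairsWhere : List ℕ → (ℕ → ℕ → Bool) → List (ℕ × ℕ)
pairsWhere xs e = concatMap (λ u → pairsFrom e u xs) xs

countPairs : List ℕ → (ℕ → ℕ → Bool) → ℕ
countPairs xs e = ∑ xs (λ u → ∑ xs (λ v → [ e u v ]))

length-pairsFrom : ∀ e u vs → length (pairsFrom e u vs) ≡ ∑ vs (λ v → [ e u v ])
length-pairsFrom e u []       = refl
length-pairsFrom e u (v ∷ vs) with e u v
... | true  = cong suc (length-pairsFrom e u vs)
... | false = length-pairsFrom e u vs

length-pairsWhere : ∀ xs e → length (pairsWhere xs e) ≡ countPairs xs e
length-pairsWhere xs e = rows xs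
  where
  rows : ∀ us → length (concatMap (λ u → pairsFrom e u xs) us) ≡ ∑ us (λ u → ∑ xs (λ v → [ e u v ]))
  rows []       = refl
  rows (u ∷ us) = trans (length-++ (pairsFrom e u xs)) (cong₂ _+_ (length-pairsFrom e u xs) (rows us))

filterᵇ-pairsFrom : ∀ (p : ℕ × ℕ → Bool) e u vs →
  filterᵇ p (pairsFrom e u vs) ≡ pairsFrom (λ u v → e u v ∧ p (u , v)) u vs
filterᵇ-pairsFrom p e u []       = refl
filterᵇ-pairsFrom p e u (v ∷ vs) with e u v
... | false = filterᵇ-pairsFrom p e u vs
... | true with p (u , v)
...   | true  = cong ((u , v) ∷_) (filterᵇ-pairsFrom p e u vs)
...   | false = filterᵇ-pairsFrom p e u vs

filterᵇ-pairsWhere : ∀ (p : ℕ × ℕ → Bool) xs e →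
  filterᵇ p (pairsWhere xs e) ≡ pairsWhere xs (λ u v → e u v ∧ p (u , v))
filterᵇ-pairsWhere p xs e = rows xs
  where
  rows : ∀ us → filterᵇ p (concatMap (λ u → pairsFrom e u xs) us)
              ≡ concatMap (λ u → pairsFrom (λ u v → e u v ∧ p (u , v)) u xs) us
  rows []       = refl
  rows (u ∷ us) = trans (filter-++ (T? ∘ p) (pairsFrom e u xs) _)
                        (cong₂ _++_ (filterᵇ-pairsFrom p e u xs) (rows us))

pairsWhere-cong : ∀ xs {e e′ : ℕ → ℕ → Bool} → (∀ u v → e u v ≡ e′ u v) →
                  pairsWhere xs e ≡ pairsWhere xs e′
pairsWhere-cong xs e≗e′ =
  concatMap-cong (λ u → concatMap-cong (λ v → cong (λ b → if b then _ else []) (e≗e′ u v)) xs) xs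

countPairs-cong : ∀ xs {e e′ : ℕ → ℕ → Bool} → (∀ u v → e u v ≡ e′ u v) →
                  countPairs xs e ≡ countPairs xs e′
countPairs-cong xs e≗e′ = ∑-cong xs (λ u _ → ∑-cong xs (λ v _ → cong [_] (e≗e′ u v)))

countPairs-filterᵇ : ∀ (P : ℕ → Bool) xs e →
                     countPairs (filterᵇ P xs) e ≡ countPairs xs (λ u v → (P u ∧ P v) ∧ e u v)
countPairs-filterᵇ P xs e = trans (∑-filterᵇ P xs _) (∑-cong xs row)
  where
  row : ∀ u → u ∈ xs → (if P u then ∑ (filterᵇ P xs) (λ v → [ e u v ]) else 0)
                     ≡ ∑ xs (λ v → [ (P u ∧ P v) ∧ e u v ])
  row u _ with P u
  ... | true  = trans (∑-filterᵇ P xs _) (∑-cong xs (λ v _ → entry v))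
    where
    entry : ∀ v → (if P v then [ e u v ] else 0) ≡ [ P v ∧ e u v ]
    entry v with P v
    ... | true  = refl
    ... | false = refl
  ... | false = sym (∑-zero xs (λ _ _ → refl))

countPairs-split : ∀ (A : ℕ → Bool) xs e →
  countPairs xs e ≡ countPairs xs (λ u v → (not (A u) ∧ not (A v)) ∧ e u v)
                  + countPairs xs (λ u v → (A u ∧ A v) ∧ e u v)
                  + countPairs xs (λ u v → e u v ∧ (A u xor A v))
countPairs-split A xs e =
  trans (∑-cong xs (λ u _ → trans (∑-cong xs (λ v _ → trichotomy (A u) (A v) (e u v))) (∑-+₃ xs _ _ _)))
        (∑-+₃ xs _ _ _)
  where
  trichotomy : ∀ a b x → [ x ] ≡ [ (not a ∧ not b) ∧ x ] + [ (a ∧ b) ∧ x ] + [ x ∧ (a xor b) ]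
  trichotomy false false false = refl
  trichotomy false false true  = refl
  trichotomy false true  false = refl
  trichotomy false true  true  = refl
  trichotomy true  false false = refl
  trichotomy true  false true  = refl
  trichotomy true  true  false = refl
  trichotomy true  true  true  = refl

-- Graphs

module _ {L : Set} where

  arcᵇ : Graph L → ℕ → ℕ → Bool
  arcᵇ G u v = is-just (adj G u v)

  ∣δ∣ : Graph L → (ℕ → Bool) → ℕ
  ∣δ∣ G A = length (cutEdges G A)

  infix 4 _≈ᴳ_

  -- Stronger than SameGraph: equal vertex lists, so all counts agree.
  _≈ᴳ_ : Graph L → Graph L → Set
  G ≈ᴳ H = V G ≡ V H × (∀ u v → adj G u v ≡ adj H u v)

  ≈ᴳ-sym : ∀ {G H : Graph L} → G ≈ᴳ H → H ≈ᴳ G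
  ≈ᴳ-sym (V≡ , adj≡) = sym V≡ , λ u v → sym (adj≡ u v)

  ≈ᴳ-trans : ∀ {G H K : Graph L} → G ≈ᴳ H → H ≈ᴳ K → G ≈ᴳ K
  ≈ᴳ-trans (V≡ , adj≡) (V≡′ , adj≡′) = trans V≡ V≡′ , λ u v → trans (adj≡ u v) (adj≡′ u v)

  ≈ᴳ⇒SameGraph : ∀ {G H : Graph L} → G ≈ᴳ H → SameGraph G H
  ≈ᴳ⇒SameGraph (V≡ , adj≡) = (λ x → subst (x ∈_) V≡ , subst (x ∈_) (sym V≡)) , adj≡

  spanning-cong : ∀ {G H : Graph L} keep → G ≈ᴳ H → spanning G keep ≈ᴳ spanning H keep
  spanning-cong keep (V≡ , adj≡) = V≡ , λ u v → cong (λ m → if keep u v then m else nothing) (adj≡ u v)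

  ∣E∣-count : ∀ (G : Graph L) → ∣E∣ G ≡ countPairs (V G) (arcᵇ G)
  ∣E∣-count G = length-pairsWhere (V G) (arcᵇ G)

  ∣E∣-cong : ∀ {G H : Graph L} → G ≈ᴳ H → ∣E∣ G ≡ ∣E∣ H
  ∣E∣-cong {G} {H} (V≡ , adj≡) = begin
    ∣E∣ G                         ≡⟨ ∣E∣-count G ⟩
    countPairs (V G) (arcᵇ G)     ≡⟨ cong (λ xs → countPairs xs (arcᵇ G)) V≡ ⟩
    countPairs (V H) (arcᵇ G)     ≡⟨ countPairs-cong (V H) (λ u v → cong is-just (adj≡ u v)) ⟩
    countPairs (V H) (arcᵇ H)     ≡⟨ ∣E∣-count H ⟨
    ∣E∣ H                         ∎
    where open ≡-Reasoning

  pt-cong : ∀ lam {G H : Graph L} → G ≈ᴳ H → pt lam G ≡ pt lam H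
  pt-cong lam G≈H@(V≡ , _) = cong₂ (λ e n → lam ℚ.* ℕ→ℚ e ℚ.+ lam' lam ℚ.* (ℕ→ℚ n ℚ.- 1ℚ))
                                   (∣E∣-cong G≈H) (cong length V≡)

  adj-induced : ∀ (G : Graph L) P {u v} → u ∈ V (induced G P) → v ∈ V (induced G P) →
                adj (induced G P) u v ≡ adj G u v
  adj-induced G P u∈ v∈
    rewrite proj₂ (∈-filterᵇ⁻ P {xs = V G} u∈) | proj₂ (∈-filterᵇ⁻ P {xs = V G} v∈) = refl

  induced-cong : ∀ (G : Graph L) {P Q} → (∀ x → P x ≡ Q x) → induced G P ≈ᴳ induced G Q
  induced-cong G P≗Q = filterᵇ-cong P≗Q (V G) , λ u v → cong (λ b → if b then adj G u v else nothing)
                                                             (cong₂ _∧_ (P≗Q u) (P≗Q v))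

  ∖-cong : ∀ (G : Graph L) {P Q} → (∀ x → P x ≡ Q x) → G ∖ P ≈ᴳ G ∖ Q
  ∖-cong G P≗Q = induced-cong G (λ x → cong not (P≗Q x))

  ∖-∅ : ∀ (G : Graph L) → G ∖ (λ _ → false) ≈ᴳ G
  ∖-∅ G = filterᵇ-true (λ _ → true) (λ _ → refl) (V G) , λ _ _ → refl

  ∖-∨ : ∀ (G : Graph L) (P Q : ℕ → Bool) → G ∖ (λ x → Q x ∨ P x) ≈ᴳ (G ∖ P) ∖ Q
  ∖-∨ G P Q = V≡ , λ u v → arcs (P u) (P v) (Q u) (Q v) (adj G u v)
    where
    V≡ : V (G ∖ (λ x → Q x ∨ P x)) ≡ V ((G ∖ P) ∖ Q)
    V≡ = trans (filterᵇ-cong (λ x → de-Morgan (Q x) (P x)) (V G))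
               (sym (filterᵇ-filterᵇ (not ∘ Q) (not ∘ P) (V G)))
      where
      de-Morgan : ∀ a b → not (a ∨ b) ≡ not b ∧ not a
      de-Morgan false false = refl
      de-Morgan false true  = refl
      de-Morgan true  false = refl
      de-Morgan true  true  = refl
    arcs : ∀ pu pv qu qv (m : Maybe L) →
           (if not (qu ∨ pu) ∧ not (qv ∨ pv) then m else nothing)
           ≡ (if not qu ∧ not qv then (if not pu ∧ not pv then m else nothing) else nothing)
    arcs pu    pv    true  qv    m = refl
    arcs true  pv    false true  m = refl
    arcs true  pv    false false m = refl
    arcs false pv    false true  m = refl
    arcs false true  false false m = refl
    arcs false false false false m = refl

  WF-sub : (G H : Graph L) → WF G → Unique (V H) →
           (∀ u v ℓ → adj H u v ≡ just ℓ → adj G u v ≡ just ℓ × u ∈ V H × v ∈ V H) → WF H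
  WF-sub G H wfG unique sub = record
    { V-unique   = unique
    ; adj-V      = λ u v ℓ e → let (uv∈G , u∈ , v∈) = sub u v ℓ e in
                               u∈ , v∈ , proj₂ (proj₂ (WF.adj-V wfG u v ℓ uv∈G))
    ; adj-simple = simple
    }
    where
    simple : ∀ u v ℓ → adj H u v ≡ just ℓ → adj H v u ≡ nothing
    simple u v ℓ e with adj H v u in e′
    ... | nothing = refl
    ... | just ℓ′
      with () ← trans (sym (proj₁ (sub v u ℓ′ e′))) (WF.adj-simple wfG u v ℓ (proj₁ (sub u v ℓ e)))

  WF-induced : ∀ (G : Graph L) P → WF G → WF (induced G P)
  WF-induced G P wfG = WF-sub G (induced G P) wfG (Unique-filterᵇ P (WF.V-unique wfG)) sub
    where
    sub : ∀ u v ℓ → adj (induced G P) u v ≡ just ℓ →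
          adj G u v ≡ just ℓ × u ∈ V (induced G P) × v ∈ V (induced G P)
    sub u v ℓ e with P u in Pu | P v in Pv
    ... | true  | true  = let (u∈ , v∈ , _) = WF.adj-V wfG u v ℓ e in
                          e , ∈-filterᵇ⁺ P u∈ Pu , ∈-filterᵇ⁺ P v∈ Pv
    ... | true  | false with () ← e
    ... | false | _     with () ← e

  WF-spanning : ∀ (G : Graph L) keep → WF G → WF (spanning G keep)
  WF-spanning G keep wfG = WF-sub G (spanning G keep) wfG (WF.V-unique wfG) sub
    where
    sub : ∀ u v ℓ → adj (spanning G keep) u v ≡ just ℓ → adj G u v ≡ just ℓ × u ∈ V G × v ∈ V G
    sub u v ℓ e with keep u v
    ... | true  = let (u∈ , v∈ , _) = WF.adj-V wfG u v ℓ e in e , u∈ , v∈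
    ... | false with () ← e

  WF-deleteCutExcept : ∀ (G : Graph L) S keep → WF G → WF (deleteCutExcept G S keep)
  WF-deleteCutExcept G S keep wfG = WF-sub G (deleteCutExcept G S keep) wfG (WF.V-unique wfG) sub
    where
    sub : ∀ u v ℓ → adj (deleteCutExcept G S keep) u v ≡ just ℓ → adj G u v ≡ just ℓ × u ∈ V G × v ∈ V G
    sub u v ℓ e with (S u xor S v) ∧ not (keep u v)
    ... | false = let (u∈ , v∈ , _) = WF.adj-V wfG u v ℓ e in e , u∈ , v∈
    ... | true with () ← e

  WF-no-loop : ∀ {G : Graph L} → WF G → ∀ u → arcᵇ G u u ≡ false
  WF-no-loop {G} wfG u with adj G u u in e
  ... | nothing = refl
  ... | just ℓ  = ⊥-elim (proj₂ (proj₂ (WF.adj-V wfG u u ℓ e)) refl)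

  WF-Adj-irrefl : ∀ {G : Graph L} → WF G → ∀ {u} → Adj G u u → ⊥
  WF-Adj-irrefl {G} wfG {u} u~u with arcᵇ G u u | WF-no-loop wfG u
  WF-Adj-irrefl wfG (inj₁ ()) | false | refl
  WF-Adj-irrefl wfG (inj₂ ()) | false | refl

  WF-Adj-one-arc : ∀ {G : Graph L} → WF G → ∀ {a b} → Adj G a b → [ arcᵇ G a b ] + [ arcᵇ G b a ] ≡ 1
  WF-Adj-one-arc {G} wfG {a} {b} a~b with adj G a b in e₁ | adj G b a in e₂
  ... | just ℓ  | just ℓ′ with () ← trans (sym e₂) (WF.adj-simple wfG a b ℓ e₁)
  ... | just ℓ  | nothing = refl
  ... | nothing | just ℓ′ = refl
  ... | nothing | nothing with a~b
  ...   | inj₁ ()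
  ...   | inj₂ ()

  Adj-sym : ∀ (G : Graph L) {a b} → Adj G a b → Adj G b a
  Adj-sym G (inj₁ p) = inj₂ p
  Adj-sym G (inj₂ p) = inj₁ p

  Adj-transport : ∀ (G H : Graph L) {a b} → adj G a b ≡ adj H a b → adj G b a ≡ adj H b a →
                  Adj G a b → Adj H a b
  Adj-transport G H ab≡ ba≡ (inj₁ p) = inj₁ (trans (cong is-just (sym ab≡)) p)
  Adj-transport G H ab≡ ba≡ (inj₂ p) = inj₂ (trans (cong is-just (sym ba≡)) p)

  Adj-induced⁺ : ∀ (G : Graph L) P {a b} → a ∈ V (induced G P) → b ∈ V (induced G P) →
                 Adj G a b → Adj (induced G P) a b
  Adj-induced⁺ G P a∈ b∈ =
    Adj-transport G (induced G P) (sym (adj-induced G P a∈ b∈)) (sym (adj-induced G P b∈ a∈))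

  Adj-induced⁻ : ∀ (G : Graph L) P {a b} → a ∈ V (induced G P) → b ∈ V (induced G P) →
                 Adj (induced G P) a b → Adj G a b
  Adj-induced⁻ G P a∈ b∈ = Adj-transport (induced G P) G (adj-induced G P a∈ b∈) (adj-induced G P b∈ a∈)

  Reach-trans : ∀ {G : Graph L} {p q s} → Reach G p q → Reach G q s → Reach G p s
  Reach-trans here       r = r
  Reach-trans (step a r) r′ = step a (Reach-trans r r′)

  Reach-sym : ∀ {G : Graph L} {p q} → Reach G p q → Reach G q p
  Reach-sym here       = here
  Reach-sym {G} (step a r) = Reach-trans (Reach-sym r) (step (Adj-sym G a) here)

  Reach-mono : ∀ {G H : Graph L} → (∀ a b → IsJust (adj G a b) → IsJust (adj H a b)) →
               ∀ {p q} → Reach G p q → Reach H p q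
  Reach-mono G⊆H here               = here
  Reach-mono G⊆H (step (inj₁ a) r) = step (inj₁ (G⊆H _ _ a)) (Reach-mono G⊆H r)
  Reach-mono G⊆H (step (inj₂ a) r) = step (inj₂ (G⊆H _ _ a)) (Reach-mono G⊆H r)

  induced-arc-mono : ∀ (G : Graph L) {P Q} → (∀ x → P x ≡ true → Q x ≡ true) →
                     ∀ a b → IsJust (adj (induced G P) a b) → IsJust (adj (induced G Q) a b)
  induced-arc-mono G {P} P⊆Q a b arc with P a in Pa | P b in Pb
  ... | true | true rewrite P⊆Q a Pa | P⊆Q b Pb = arc

  -- X ∪ {w} is still connected, so maximality puts w in X.
  IsComponent-closed : ∀ (H : Graph L) X → IsComponent H X →
    ∀ {x w} → x ∈ V H → X x ≡ true → w ∈ V H → Adj H x w → X w ≡ true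
  IsComponent-closed H X (_ , connected , maximal) {x} {w} x∈H Xx w∈H x~w =
    maximal Y X⊆Y connectedY w w∈H Yw
    where
    Y : ℕ → Bool
    Y y = X y ∨ (y ≡ᵇ w)
    X⊆Y′ : ∀ y → X y ≡ true → Y y ≡ true
    X⊆Y′ y Xy rewrite Xy = refl
    X⊆Y : X ⊆ᵥ Y [ H ]
    X⊆Y y _ = X⊆Y′ y
    Yw : Y w ≡ true
    Yw rewrite ≡ᵇ-refl w = ∨-zeroʳ (X w)
    x∈Y : x ∈ V (induced H Y)
    x∈Y = ∈-filterᵇ⁺ Y x∈H (X⊆Y′ x Xx)
    w∈Y : w ∈ V (induced H Y)
    w∈Y = ∈-filterᵇ⁺ Y w∈H Yw
    reaches-x : ∀ p → p ∈ V (induced H Y) → Reach (induced H Y) p x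
    reaches-x p p∈ with ∈-filterᵇ⁻ Y {xs = V H} p∈
    ... | p∈H , Yp with X p in Xp
    ...   | true  = Reach-mono (induced-arc-mono H X⊆Y′)
                      (connected p x (∈-filterᵇ⁺ X p∈H Xp) (∈-filterᵇ⁺ X x∈H Xx))
    ...   | false with refl ← ≡ᵇ-true⇒≡ {p} {w} Yp =
      step (Adj-sym (induced H Y) (Adj-induced⁺ H Y x∈Y w∈Y x~w)) here
    connectedY : Connected (induced H Y)
    connectedY p q p∈ q∈ = Reach-trans (reaches-x p p∈) (Reach-sym (reaches-x q q∈))

  ∣V∣-induced : ∀ (G : Graph L) P → ∣V∣ (induced G P) ≡ ∑ (V G) (λ x → [ P x ])
  ∣V∣-induced G P = length-filterᵇ P (V G)

  ∣V∣-split : ∀ (G : Graph L) A → ∣V∣ G ≡ ∣V∣ (G ∖ A) + ∣V∣ (induced G A)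
  ∣V∣-split G A = length-filterᵇ-split A (V G)

  ∣E∣-induced : ∀ (G : Graph L) P →
                ∣E∣ (induced G P) ≡ countPairs (V G) (λ u v → (P u ∧ P v) ∧ arcᵇ G u v)
  ∣E∣-induced G P = trans (∣E∣-count (induced G P))
    (trans (countPairs-filterᵇ P (V G) _) (countPairs-cong (V G) (λ u v → guarded (P u ∧ P v) (adj G u v))))
    where
    guarded : ∀ b (m : Maybe L) → b ∧ is-just (if b then m else nothing) ≡ b ∧ is-just m
    guarded true  m = refl
    guarded false m = refl

  cutEdges-pairsWhere : ∀ (G : Graph L) A → cutEdges G A ≡ pairsWhere (V G) (λ u v → arcᵇ G u v ∧ (A u xor A v))
  cutEdges-pairsWhere G A = filterᵇ-pairsWhere _ (V G) (arcᵇ G)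

  ∣δ∣-count : ∀ (G : Graph L) A → ∣δ∣ G A ≡ countPairs (V G) (λ u v → arcᵇ G u v ∧ (A u xor A v))
  ∣δ∣-count G A = trans (cong length (cutEdges-pairsWhere G A)) (length-pairsWhere (V G) _)

  ∣E∣-split : ∀ (G : Graph L) A → ∣E∣ G ≡ ∣E∣ (G ∖ A) + ∣E∣ (induced G A) + ∣δ∣ G A
  ∣E∣-split G A = begin
    ∣E∣ G                                            ≡⟨ ∣E∣-count G ⟩
    countPairs (V G) (arcᵇ G)                        ≡⟨ countPairs-split A (V G) (arcᵇ G) ⟩
    countPairs (V G) _ + countPairs (V G) _ + countPairs (V G) _
      ≡⟨ cong₂ _+_ (cong₂ _+_ (∣E∣-induced G (not ∘ A)) (∣E∣-induced G A)) (∣δ∣-count G A) ⟨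
    ∣E∣ (G ∖ A) + ∣E∣ (induced G A) + ∣δ∣ G A       ∎
    where open ≡-Reasoning

  ∖-spanning : ∀ (G : Graph L) A {keep keep′} →
               (∀ u v → A u ≡ false → A v ≡ false → keep u v ≡ keep′ u v) →
               spanning G keep ∖ A ≈ᴳ spanning (G ∖ A) keep′
  ∖-spanning G A {keep} {keep′} agree = refl , arcs
    where
    arcs : ∀ u v → adj (spanning G keep ∖ A) u v ≡ adj (spanning (G ∖ A) keep′) u v
    arcs u v with A u in Au | A v in Av
    ... | true  | _     with keep′ u v
    ...   | true  = refl
    ...   | false = refl
    arcs u v | false | true  with keep′ u v
    ...   | true  = refl
    ...   | false = refl
    arcs u v | false | false rewrite agree u v Au Av = refl

  induced-spanning : ∀ (G : Graph L) A {keep} → (∀ u v → A u ≡ true → A v ≡ true → keep u v ≡ true) →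
                     induced (spanning G keep) A ≈ᴳ induced G A
  induced-spanning G A {keep} kept = refl , arcs
    where
    arcs : ∀ u v → adj (induced (spanning G keep) A) u v ≡ adj (induced G A) u v
    arcs u v with A u in Au | A v in Av
    ... | true  | true  rewrite kept u v Au Av = refl
    ... | true  | false = refl
    ... | false | _     = refl

  cutEdges-spanning : ∀ (G : Graph L) A {keep} → (∀ u v → (A u xor A v) ≡ true → keep u v ≡ true) →
                      cutEdges (spanning G keep) A ≡ cutEdges G A
  cutEdges-spanning G A {keep} kept =
    trans (cutEdges-pairsWhere (spanning G keep) A)
          (trans (pairsWhere-cong (V G) arcs) (sym (cutEdges-pairsWhere G A)))
    where
    arcs : ∀ u v → arcᵇ (spanning G keep) u v ∧ (A u xor A v) ≡ arcᵇ G u v ∧ (A u xor A v)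
    arcs u v with A u xor A v in crossing
    ... | true  rewrite kept u v crossing = refl
    ... | false = trans (∧-zeroʳ _) (sym (∧-zeroʳ _))

  deleteCutExcept-∖ : ∀ (G : Graph L) S keep → deleteCutExcept G S keep ∖ S ≈ᴳ G ∖ S
  deleteCutExcept-∖ G S keep = refl , λ u v → arcs (S u) (S v) (keep u v) (adj G u v)
    where
    arcs : ∀ su sv k (m : Maybe L) →
           (if not su ∧ not sv then (if (su xor sv) ∧ not k then nothing else m) else nothing)
           ≡ (if not su ∧ not sv then m else nothing)
    arcs true  sv    k m = refl
    arcs false true  k m = refl
    arcs false false k m = refl

  deleteCutExcept-induced : ∀ (G : Graph L) S keep → induced (deleteCutExcept G S keep) S ≈ᴳ induced G S
  deleteCutExcept-induced G S keep = refl , λ u v → arcs (S u) (S v) (keep u v) (adj G u v)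
    where
    arcs : ∀ su sv k (m : Maybe L) →
           (if su ∧ sv then (if (su xor sv) ∧ not k then nothing else m) else nothing)
           ≡ (if su ∧ sv then m else nothing)
    arcs true  true  k m = refl
    arcs true  false k m = refl
    arcs false sv    k m = refl

  cutEdges-deleteCutExcept : ∀ (G : Graph L) S keep → cutEdges (deleteCutExcept G S keep) S ≡ keptCutEdges G S keep
  cutEdges-deleteCutExcept G S keep = begin
    cutEdges (deleteCutExcept G S keep) S
      ≡⟨ cutEdges-pairsWhere (deleteCutExcept G S keep) S ⟩
    pairsWhere (V G) _
      ≡⟨ pairsWhere-cong (V G) (λ u v → arcs (S u xor S v) (keep u v) (adj G u v)) ⟩
    pairsWhere (V G) (λ u v → (arcᵇ G u v ∧ (S u xor S v)) ∧ keep u v)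
      ≡⟨ filterᵇ-pairsWhere _ (V G) _ ⟨
    filterᵇ (λ { (u , v) → keep u v }) (pairsWhere (V G) (λ u v → arcᵇ G u v ∧ (S u xor S v)))
      ≡⟨ cong (filterᵇ (λ { (u , v) → keep u v })) (cutEdges-pairsWhere G S) ⟨
    keptCutEdges G S keep
      ∎
    where
    open ≡-Reasoning
    arcs : ∀ c k (m : Maybe L) → is-just (if c ∧ not k then nothing else m) ∧ c ≡ (is-just m ∧ c) ∧ k
    arcs true  true  (just _) = refl
    arcs true  true  nothing  = refl
    arcs true  false (just _) = refl
    arcs true  false nothing  = refl
    arcs false k     (just _) = refl
    arcs false k     nothing  = refl

  K₂-counts : ∀ (G : Graph L) → WF G → ∀ {a b} → a ∈ V G → b ∈ V G → a ≢ b → Adj G a b →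
              ∣V∣ (induced G (pairᵇ a b)) ≡ 2 × ∣E∣ (induced G (pairᵇ a b)) ≡ 1
  K₂-counts G wfG {a} {b} a∈ b∈ a≢b a~b = vertices , edges′
    where
    open ≡-Reasoning
    A : ℕ → Bool
    A = pairᵇ a b
    unique : Unique (V G)
    unique = WF.V-unique wfG
    Aa : A a ≡ true
    Aa rewrite ≡ᵇ-refl a = refl
    Ab : A b ≡ true
    Ab rewrite ≡ᵇ-refl b = ∨-zeroʳ _
    A-other : ∀ x → x ≢ a → x ≢ b → A x ≡ false
    A-other x x≢a x≢b rewrite ≢⇒≡ᵇ-false x≢a | ≢⇒≡ᵇ-false x≢b = refl
    vertices : ∣V∣ (induced G A) ≡ 2
    vertices = begin
      ∣V∣ (induced G A)       ≡⟨ ∣V∣-induced G A ⟩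
      ∑ (V G) (λ x → [ A x ])
        ≡⟨ ∑-two (V G) _ unique a∈ b∈ a≢b (λ x _ x≢a x≢b → cong [_] (A-other x x≢a x≢b)) ⟩
      [ A a ] + [ A b ]       ≡⟨ cong₂ (λ p q → [ p ] + [ q ]) Aa Ab ⟩
      2                       ∎
    row : ℕ → ℕ
    row u = ∑ (V G) (λ w → [ (A u ∧ A w) ∧ arcᵇ G u w ])
    row-outside : ∀ u → A u ≡ false → row u ≡ 0
    row-outside u Au rewrite Au = ∑-zero (V G) (λ _ _ → refl)
    row-inside : ∀ u → A u ≡ true → row u ≡ [ arcᵇ G u a ] + [ arcᵇ G u b ]
    row-inside u Au rewrite Au =
      trans (∑-two (V G) _ unique a∈ b∈ a≢b
                   (λ x _ x≢a x≢b → cong (λ t → [ t ∧ arcᵇ G u x ]) (A-other x x≢a x≢b)))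
            (cong₂ (λ p q → [ p ∧ arcᵇ G u a ] + [ q ∧ arcᵇ G u b ]) Aa Ab)
    edges′ : ∣E∣ (induced G A) ≡ 1
    edges′ = begin
      ∣E∣ (induced G A)
        ≡⟨ ∣E∣-induced G A ⟩
      ∑ (V G) row
        ≡⟨ ∑-two (V G) row unique a∈ b∈ a≢b (λ x _ x≢a x≢b → row-outside x (A-other x x≢a x≢b)) ⟩
      row a + row b
        ≡⟨ cong₂ _+_ (row-inside a Aa) (row-inside b Ab) ⟩
      ([ arcᵇ G a a ] + [ arcᵇ G a b ]) + ([ arcᵇ G b a ] + [ arcᵇ G b b ])
        ≡⟨ cong₂ (λ p q → ([ p ] + [ arcᵇ G a b ]) + ([ arcᵇ G b a ] + [ q ]))
                 (WF-no-loop wfG a) (WF-no-loop wfG b) ⟩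
      [ arcᵇ G a b ] + ([ arcᵇ G b a ] + 0)
        ≡⟨ cong ([ arcᵇ G a b ] +_) (+-identityʳ _) ⟩
      [ arcᵇ G a b ] + [ arcᵇ G b a ]
        ≡⟨ WF-Adj-one-arc wfG a~b ⟩
      1 ∎

  pendant-counts : ∀ (G : Graph L) → WF G → ∀ {x y} → x ∈ V G → y ∈ V G → x ≢ y → Adj G x y →
                   (∀ w → w ∈ V G → Adj G x w → w ≡ y) →
                   ∣V∣ (induced G (_≡ᵇ x)) ≡ 1 × ∣E∣ (induced G (_≡ᵇ x)) ≡ 0 × ∣δ∣ G (_≡ᵇ x) ≡ 1
  pendant-counts G wfG {x} {y} x∈ y∈ x≢y x~y only-y = vertices , edges′ , cut
    where
    open ≡-Reasoning
    unique : Unique (V G)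
    unique = WF.V-unique wfG
    y≢x : (y ≡ᵇ x) ≡ false
    y≢x = ≢⇒≡ᵇ-false (x≢y ∘ sym)
    vertices : ∣V∣ (induced G (_≡ᵇ x)) ≡ 1
    vertices = trans (∣V∣-induced G (_≡ᵇ x))
      (trans (∑-one (V G) _ unique x∈ (λ u _ u≢x → cong [_] (≢⇒≡ᵇ-false u≢x))) (cong [_] (≡ᵇ-refl x)))
    no-inner : ∀ u w → [ ((u ≡ᵇ x) ∧ (w ≡ᵇ x)) ∧ arcᵇ G u w ] ≡ 0
    no-inner u w with u ≡ᵇ x in ux | w ≡ᵇ x in wx
    ... | false | _     = refl
    ... | true  | false = refl
    ... | true  | true  with refl ← ≡ᵇ-true⇒≡ {u} {x} ux | refl ← ≡ᵇ-true⇒≡ {w} {x} wx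
                        rewrite WF-no-loop wfG u = refl
    edges′ : ∣E∣ (induced G (_≡ᵇ x)) ≡ 0
    edges′ = trans (∣E∣-induced G (_≡ᵇ x)) (∑-zero (V G) (λ u _ → ∑-zero (V G) (λ w _ → no-inner u w)))
    row : ℕ → ℕ
    row u = ∑ (V G) (λ w → [ arcᵇ G u w ∧ ((u ≡ᵇ x) xor (w ≡ᵇ x)) ])
    row-x : row x ≡ [ arcᵇ G x y ]
    row-x = trans (∑-one (V G) _ unique y∈ off) at-y
      where
      off : ∀ w → w ∈ V G → w ≢ y → [ arcᵇ G x w ∧ ((x ≡ᵇ x) xor (w ≡ᵇ x)) ] ≡ 0
      off w w∈ w≢y with arcᵇ G x w in arc
      ... | false = refl
      ... | true  = ⊥-elim (w≢y (only-y w w∈ (inj₁ arc)))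
      at-y : [ arcᵇ G x y ∧ ((x ≡ᵇ x) xor (y ≡ᵇ x)) ] ≡ [ arcᵇ G x y ]
      at-y rewrite ≡ᵇ-refl x | y≢x = cong [_] (∧-identityʳ _)
    row-y : row y ≡ [ arcᵇ G y x ]
    row-y = trans (∑-one (V G) _ unique x∈ off) at-x
      where
      off : ∀ w → w ∈ V G → w ≢ x → [ arcᵇ G y w ∧ ((y ≡ᵇ x) xor (w ≡ᵇ x)) ] ≡ 0
      off w _ w≢x rewrite y≢x | ≢⇒≡ᵇ-false w≢x = cong [_] (∧-zeroʳ _)
      at-x : [ arcᵇ G y x ∧ ((y ≡ᵇ x) xor (x ≡ᵇ x)) ] ≡ [ arcᵇ G y x ]
      at-x rewrite y≢x | ≡ᵇ-refl x = cong [_] (∧-identityʳ _)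
    row-other : ∀ u → u ∈ V G → u ≢ x → u ≢ y → row u ≡ 0
    row-other u u∈ u≢x u≢y = ∑-zero (V G) entry
      where
      entry : ∀ w → w ∈ V G → [ arcᵇ G u w ∧ ((u ≡ᵇ x) xor (w ≡ᵇ x)) ] ≡ 0
      entry w _ rewrite ≢⇒≡ᵇ-false u≢x with w ≡ᵇ x in wx
      ... | false = cong [_] (∧-zeroʳ _)
      ... | true  with refl ← ≡ᵇ-true⇒≡ {w} {x} wx with arcᵇ G u w in arc
      ...   | false = refl
      ...   | true  = ⊥-elim (u≢y (only-y u u∈ (inj₂ arc)))
    cut : ∣δ∣ G (_≡ᵇ x) ≡ 1
    cut = begin
      ∣δ∣ G (_≡ᵇ x)                    ≡⟨ ∣δ∣-count G (_≡ᵇ x) ⟩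
      ∑ (V G) row                      ≡⟨ ∑-two (V G) row unique x∈ y∈ x≢y row-other ⟩
      row x + row y                    ≡⟨ cong₂ _+_ row-x row-y ⟩
      [ arcᵇ G x y ] + [ arcᵇ G y x ] ≡⟨ WF-Adj-one-arc wfG x~y ⟩
      1                                ∎

-- Rational arithmetic

ℕ→ℚ-+ : ∀ m n → ℕ→ℚ (m + n) ≡ ℕ→ℚ m ℚ.+ ℕ→ℚ n
ℕ→ℚ-+ m n = sym (trans (cong₂ ℚ._+_ (ℕ→ℚ-mkℚ m) (ℕ→ℚ-mkℚ n))
                       (cong (ℚ._/ 1) (cong₂ ℤ._+_ (ℤₚ.*-identityʳ (ℤ.+ m)) (ℤₚ.*-identityʳ (ℤ.+ n)))))
  where
  ℕ→ℚ-mkℚ : ∀ n → ℕ→ℚ n ≡ mkℚ (ℤ.+ n) 0 (coprime-sym (1-coprimeTo n))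
  ℕ→ℚ-mkℚ n = ℚₚ.normalize-coprime (coprime-sym (1-coprimeTo n))

ℕ→ℚ-suc : ∀ n → ℕ→ℚ (suc n) ≡ 1ℚ ℚ.+ ℕ→ℚ n
ℕ→ℚ-suc = ℕ→ℚ-+ 1

ℕ→ℚ-nonNeg : ∀ n → 0ℚ ≤ ℕ→ℚ n
ℕ→ℚ-nonNeg n rewrite ℚₚ.normalize-coprime (coprime-sym (1-coprimeTo n)) = ℚₚ.nonNegative⁻¹ _

ptIncrease : ℚ → ℕ → ℕ → ℕ → ℚ
ptIncrease lam eA vA d = lam ℚ.* ℕ→ℚ (eA + d) ℚ.+ lam' lam ℚ.* ℕ→ℚ vA

pt-split : ∀ {L} lam (G : Graph L) A →
  pt lam G ≡ pt lam (G ∖ A) ℚ.+ ptIncrease lam (∣E∣ (induced G A)) (∣V∣ (induced G A)) (∣δ∣ G A)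
pt-split lam G A =
  trans (cong₂ (λ e n → lam ℚ.* ℕ→ℚ e ℚ.+ lam' lam ℚ.* (ℕ→ℚ n ℚ.- 1ℚ))
               (∣E∣-split G A) (∣V∣-split G A))
        (arith (∣E∣ (G ∖ A)) (∣E∣ (induced G A)) (∣δ∣ G A) (∣V∣ (G ∖ A)) (∣V∣ (induced G A)))
  where
  open +-*-Solver
  arith : ∀ eB eA d vB vA →
    lam ℚ.* ℕ→ℚ (eB + eA + d) ℚ.+ lam' lam ℚ.* (ℕ→ℚ (vB + vA) ℚ.- 1ℚ)
    ≡ (lam ℚ.* ℕ→ℚ eB ℚ.+ lam' lam ℚ.* (ℕ→ℚ vB ℚ.- 1ℚ)) ℚ.+ ptIncrease lam eA vA d
  arith eB eA d vB vA rewrite ℕ→ℚ-+ (eB + eA) d | ℕ→ℚ-+ eB eA | ℕ→ℚ-+ eA d | ℕ→ℚ-+ vB vA =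
    solve 6 (λ l eb ea dd vb va →
                 l :* ((eb :+ ea) :+ dd) :+ con ½ :* (con 1ℚ :- l) :* ((vb :+ va) :- con 1ℚ)
              := (l :* eb :+ con ½ :* (con 1ℚ :- l) :* (vb :- con 1ℚ))
                 :+ (l :* (ea :+ dd) :+ con ½ :* (con 1ℚ :- l) :* va))
            refl lam (ℕ→ℚ eB) (ℕ→ℚ eA) (ℕ→ℚ d) (ℕ→ℚ vB) (ℕ→ℚ vA)

-- The increase is exactly 1 + λ d.
K₂-affordable : ∀ lam d f → lam ℚ.* ℕ→ℚ d ≤ ℕ→ℚ f → ptIncrease lam 1 2 d ≤ ℕ→ℚ (1 + f)
K₂-affordable lam d f λd≤f rewrite ℕ→ℚ-suc d | ℕ→ℚ-suc f =
  subst (_≤ 1ℚ ℚ.+ ℕ→ℚ f) (sym increase) (ℚₚ.+-monoʳ-≤ 1ℚ λd≤f)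
  where
  open +-*-Solver
  increase : lam ℚ.* (1ℚ ℚ.+ ℕ→ℚ d) ℚ.+ lam' lam ℚ.* ℕ→ℚ 2 ≡ 1ℚ ℚ.+ lam ℚ.* ℕ→ℚ d
  increase = solve 2 (λ l dd → l :* (con 1ℚ :+ dd) :+ con ½ :* (con 1ℚ :- l) :* con (ℕ→ℚ 2)
                               := con 1ℚ :+ l :* dd) refl lam (ℕ→ℚ d)

-- The increase is (1 + λ)/2 ≤ 1, and f ≥ λ > 0 forces f ≥ 1.
pendant-affordable : ∀ {lam} → 0ℚ < lam → lam < 1ℚ → ∀ f → lam ℚ.* ℕ→ℚ 1 ≤ ℕ→ℚ f →
                     ptIncrease lam 0 1 1 ≤ ℕ→ℚ (0 + f)
pendant-affordable {lam} 0<lam lam<1 f λ≤f = ℚₚ.≤-trans increase≤1 (1≤ f λ≤f)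
  where
  open +-*-Solver
  increase≡ : ptIncrease lam 0 1 1 ≡ ½ ℚ.+ ½ ℚ.* lam
  increase≡ = solve 1 (λ l → l :* con 1ℚ :+ con ½ :* (con 1ℚ :- l) :* con 1ℚ := con ½ :+ con ½ :* l) refl lam
  increase≤1 : ptIncrease lam 0 1 1 ≤ 1ℚ
  increase≤1 = subst (_≤ 1ℚ) (sym increase≡)
    (ℚₚ.+-monoʳ-≤ ½ (subst (½ ℚ.* lam ≤_) (ℚₚ.*-identityʳ ½)
                           (ℚₚ.*-monoˡ-≤-nonNeg ½ (ℚₚ.<⇒≤ lam<1))))
  1≤ : ∀ f → lam ℚ.* ℕ→ℚ 1 ≤ ℕ→ℚ f → 1ℚ ≤ ℕ→ℚ f
  1≤ zero    λ≤0 =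
    ⊥-elim (ℚₚ.<-irrefl refl (ℚₚ.<-≤-trans 0<lam (subst (_≤ 0ℚ) (ℚₚ.*-identityʳ lam) λ≤0)))
  1≤ (suc f) _   = subst (1ℚ ≤_) (sym (ℕ→ℚ-suc f))
                     (subst (_≤ 1ℚ ℚ.+ ℕ→ℚ f) (ℚₚ.+-identityʳ 1ℚ) (ℚₚ.+-monoʳ-≤ 1ℚ (ℕ→ℚ-nonNeg f)))

-- Adding back a vertex set

module _ {L : Set} {lam : ℚ} {Π : Graph L → Set} (SE : StronglyExtendible lam Π) where
  open StronglyExtendible SE

  cost-one : ∀ es → cost {L = L} (λ _ _ → 1ℚ) es ≡ ℕ→ℚ (length es)
  cost-one []             = refl
  cost-one ((u , v) ∷ es) = trans (cong (1ℚ ℚ.+_) (cost-one es)) (sym (ℕ→ℚ-suc (length es)))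

  GoodSpanning-cong : ∀ {G H : Graph L} {k} → WF G → G ≈ᴳ H → GoodSpanning lam Π G k → GoodSpanning lam Π H k
  GoodSpanning-cong {G} {H} {k} wfG G≈H (keep , πG , enough) =
    keep , respects (spanning G keep) (spanning H keep) (WF-spanning G keep wfG) (≈ᴳ⇒SameGraph S≈) πG ,
    subst₂ (λ p e → p ℚ.+ k ≤ ℕ→ℚ e) (pt-cong lam G≈H) (∣E∣-cong S≈) enough
    where
    S≈ : spanning G keep ≈ᴳ spanning H keep
    S≈ = spanning-cong keep G≈H

  -- λ-extendibility with unit costs, applied to the spanning subgraph W of K that keeps
  -- every edge at A and the given edges elsewhere.
  extendSpanning : ∀ (K : Graph L) → WF K → ∀ A → Π (induced K A) →
    ∀ keep → Π (spanning (K ∖ A) keep) →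
    Σ (ℕ → ℕ → Bool) λ keep′ → Π (spanning K keep′) ×
      Σ ℕ λ f → lam ℚ.* ℕ→ℚ (∣δ∣ K A) ≤ ℕ→ℚ f ×
                ∣E∣ (spanning K keep′) ≡ ∣E∣ (spanning (K ∖ A) keep) + ∣E∣ (induced K A) + f
  extendSpanning K wfK A πA keep πB =
    keep′ , π′ , length (keptCutEdges W A keepF) , λδ≤f , edges≡
    where
    keepW : ℕ → ℕ → Bool
    keepW u v = (A u ∨ A v) ∨ keep u v
    W : Graph L
    W = spanning K keepW
    wfW : WF W
    wfW = WF-spanning K keepW wfK
    W∖A≈ : W ∖ A ≈ᴳ spanning (K ∖ A) keep
    W∖A≈ = ∖-spanning K A (λ u v Au Av → cong (λ b → b ∨ keep u v) (cong₂ _∨_ Au Av))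
    W[A]≈ : induced W A ≈ᴳ induced K A
    W[A]≈ = induced-spanning K A (λ u v Au Av → cong (λ b → b ∨ keep u v) (cong (_∨ A v) Au))
    extended : Σ (ℕ → ℕ → Bool) λ keepF →
                 (lam ℚ.* cost {L = L} (λ _ _ → 1ℚ) (cutEdges W A)
                    ≤ cost {L = L} (λ _ _ → 1ℚ) (keptCutEdges W A keepF))
                 × Π (deleteCutExcept W A keepF)
    extended = extend W wfW A
      (respects (induced K A) (induced W A) (WF-induced K A wfK) (≈ᴳ⇒SameGraph (≈ᴳ-sym W[A]≈)) πA)
      (respects (spanning (K ∖ A) keep) (W ∖ A) (WF-spanning (K ∖ A) keep (WF-induced K _ wfK))
                (≈ᴳ⇒SameGraph (≈ᴳ-sym W∖A≈)) πB)
      (λ _ _ → 1ℚ) (λ _ _ _ _ _ → ℚₚ.positive⁻¹ 1ℚ)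
    keepF : ℕ → ℕ → Bool
    keepF = proj₁ extended
    D : Graph L
    D = deleteCutExcept W A keepF
    keep′ : ℕ → ℕ → Bool
    keep′ u v = not ((A u xor A v) ∧ not (keepF u v)) ∧ keepW u v
    D≈ : D ≈ᴳ spanning K keep′
    D≈ = refl , λ u v → arcs ((A u xor A v) ∧ not (keepF u v)) (keepW u v) (adj K u v)
      where
      arcs : ∀ c k (m : Maybe L) →
             (if c then nothing else (if k then m else nothing)) ≡ (if not c ∧ k then m else nothing)
      arcs true  k m = refl
      arcs false k m = refl
    π′ : Π (spanning K keep′)
    π′ = respects D (spanning K keep′) (WF-deleteCutExcept W A keepF wfW) (≈ᴳ⇒SameGraph D≈)
                  (proj₂ (proj₂ extended))
    λδ≤f : lam ℚ.* ℕ→ℚ (∣δ∣ K A) ≤ ℕ→ℚ (length (keptCutEdges W A keepF))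
    λδ≤f = subst₂ (λ c f → lam ℚ.* c ≤ f)
      (trans (cost-one (cutEdges W A)) (cong (ℕ→ℚ ∘ length) (cutEdges-spanning K A crossing-kept)))
      (cost-one (keptCutEdges W A keepF)) (proj₁ (proj₂ extended))
      where
      crossing-kept : ∀ u v → (A u xor A v) ≡ true → keepW u v ≡ true
      crossing-kept u v _ with A u | A v
      ... | true  | _    = refl
      ... | false | true = refl
    edges≡ : ∣E∣ (spanning K keep′)
             ≡ ∣E∣ (spanning (K ∖ A) keep) + ∣E∣ (induced K A) + length (keptCutEdges W A keepF)
    edges≡ = begin
      ∣E∣ (spanning K keep′)                                ≡⟨ ∣E∣-cong (≈ᴳ-sym D≈) ⟩
      ∣E∣ D                                                 ≡⟨ ∣E∣-split D A ⟩
      ∣E∣ (D ∖ A) + ∣E∣ (induced D A) + ∣δ∣ D A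
        ≡⟨ cong₂ _+_ (cong₂ _+_ (∣E∣-cong (≈ᴳ-trans (deleteCutExcept-∖ W A keepF) W∖A≈))
                                (∣E∣-cong (≈ᴳ-trans (deleteCutExcept-induced W A keepF) W[A]≈)))
                     (cong length (cutEdges-deleteCutExcept W A keepF)) ⟩
      ∣E∣ (spanning (K ∖ A) keep) + ∣E∣ (induced K A) + length (keptCutEdges W A keepF) ∎
      where open ≡-Reasoning

  GoodSpanning-addBack : ∀ {k} (K : Graph L) → WF K → ∀ A → Π (induced K A) →
    ∀ {eA vA d} → ∣E∣ (induced K A) ≡ eA → ∣V∣ (induced K A) ≡ vA → ∣δ∣ K A ≡ d →
    (∀ f → lam ℚ.* ℕ→ℚ d ≤ ℕ→ℚ f → ptIncrease lam eA vA d ≤ ℕ→ℚ (eA + f)) →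
    GoodSpanning lam Π (K ∖ A) k → GoodSpanning lam Π K k
  GoodSpanning-addBack {k} K wfK A πA {eA} refl refl refl affordable (keep , πB , enough) =
    extended (extendSpanning K wfK A πA keep πB)
    where
    eB : ℕ
    eB = ∣E∣ (spanning (K ∖ A) keep)
    increase : ℚ
    increase = ptIncrease lam eA (∣V∣ (induced K A)) (∣δ∣ K A)
    extended : (Σ (ℕ → ℕ → Bool) λ keep′ → Π (spanning K keep′) ×
                 Σ ℕ λ f → lam ℚ.* ℕ→ℚ (∣δ∣ K A) ≤ ℕ→ℚ f ×
                           ∣E∣ (spanning K keep′) ≡ eB + eA + f) →
               GoodSpanning lam Π K k
    extended (keep′ , π′ , f , λδ≤f , edges≡) = keep′ , π′ , (begin
      pt lam K ℚ.+ k                          ≡⟨ cong (ℚ._+ k) (pt-split lam K A) ⟩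
      (pt lam (K ∖ A) ℚ.+ increase) ℚ.+ k     ≡⟨ xy∙z≈xz∙y (pt lam (K ∖ A)) increase k ⟩
      (pt lam (K ∖ A) ℚ.+ k) ℚ.+ increase     ≤⟨ ℚₚ.+-mono-≤ enough (affordable f λδ≤f) ⟩
      ℕ→ℚ eB ℚ.+ ℕ→ℚ (eA + f)                 ≡⟨ ℕ→ℚ-+ eB (eA + f) ⟨
      ℕ→ℚ (eB + (eA + f))                     ≡⟨ cong ℕ→ℚ (trans (sym (+-assoc eB eA f)) (sym edges≡)) ⟩
      ℕ→ℚ (∣E∣ (spanning K keep′))            ∎)
      where open ℚₚ.≤-Reasoning

  GoodSpanning-addK₂ : ∀ {k} (K : Graph L) → WF K → ∀ {a b} → a ∈ V K → b ∈ V K → a ≢ b → Adj K a b →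
                       GoodSpanning lam Π (K ∖ pairᵇ a b) k → GoodSpanning lam Π K k
  GoodSpanning-addK₂ K wfK {a} {b} a∈ b∈ a≢b a~b =
    GoodSpanning-addBack K wfK (pairᵇ a b)
      (K1K2 (induced K (pairᵇ a b)) (WF-induced K _ wfK) (inj₂ counts)) (proj₂ counts) (proj₁ counts) refl
      (K₂-affordable lam (∣δ∣ K (pairᵇ a b)))
    where
    counts : ∣V∣ (induced K (pairᵇ a b)) ≡ 2 × ∣E∣ (induced K (pairᵇ a b)) ≡ 1
    counts = K₂-counts K wfK a∈ b∈ a≢b a~b

  GoodSpanning-addPendant : ∀ {k} → 0ℚ < lam → lam < 1ℚ → (K : Graph L) → WF K → ∀ {x y} →
    x ∈ V K → y ∈ V K → x ≢ y → Adj K x y → (∀ w → w ∈ V K → Adj K x w → w ≡ y) →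
    GoodSpanning lam Π (K ∖ (_≡ᵇ x)) k → GoodSpanning lam Π K k
  GoodSpanning-addPendant 0<lam lam<1 K wfK {x} x∈ y∈ x≢y x~y only-y =
    GoodSpanning-addBack K wfK (_≡ᵇ x) (K1K2 (induced K (_≡ᵇ x)) (WF-induced K _ wfK) (inj₁ (vertices , edges′)))
      edges′ vertices cut (pendant-affordable 0<lam lam<1)
    where
    counts : ∣V∣ (induced K (_≡ᵇ x)) ≡ 1 × ∣E∣ (induced K (_≡ᵇ x)) ≡ 0 × ∣δ∣ K (_≡ᵇ x) ≡ 1
    counts = pendant-counts K wfK x∈ y∈ x≢y x~y only-y
    vertices : ∣V∣ (induced K (_≡ᵇ x)) ≡ 1
    vertices = proj₁ counts
    edges′ : ∣E∣ (induced K (_≡ᵇ x)) ≡ 0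
    edges′ = proj₁ (proj₂ counts)
    cut : ∣δ∣ K (_≡ᵇ x) ≡ 1
    cut = proj₂ (proj₂ counts)

-- Rule 1

data EvenLength {A : Set} : List A → Set where
  nil   : EvenLength []
  cons₂ : ∀ {a b xs} → EvenLength xs → EvenLength (a ∷ b ∷ xs)

evenLength-or-cons : ∀ {A : Set} (xs : List A) →
  EvenLength xs ⊎ Σ A λ x → Σ (List A) λ ys → xs ≡ x ∷ ys × EvenLength ys
evenLength-or-cons []       = inj₁ nil
evenLength-or-cons (x ∷ xs) with evenLength-or-cons xs
... | inj₁ even                  = inj₂ (x , xs , refl , even)
... | inj₂ (y , ys , refl , even) = inj₁ (cons₂ even)

module Rule1 {L : Set} {lam : ℚ} (0<lam : 0ℚ < lam) (lam<1 : lam < 1ℚ) {Π : Graph L → Set}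
  (SE : StronglyExtendible lam Π) {k : ℚ} (G : Graph L) (wfG : WF G) (S : ℕ → Bool) (v : ℕ) (X : ℕ → Bool)
  (v∈G : v ∈ V G) (Sv : S v ≡ false) (X-avoids : X ⊆ᵥ (λ x → not (S x ∨ (x ≡ᵇ v))) [ G ])
  (X⊆V : ∀ x → X x ≡ true → x ∈ V G) (component : IsComponent (G ∖ (λ x → S x ∨ (x ≡ᵇ v))) X)
  (clique : IsClique G (λ x → X x ∨ (x ≡ᵇ v))) where

  without : List ℕ → Graph L
  without r = (G ∖ S) ∖ (_∈ᵇ r)

  xs : List ℕ
  xs = filterᵇ X (V G)

  xs-unique : Unique xs
  xs-unique = Unique-filterᵇ X (WF.V-unique wfG)

  WF-without : ∀ r → WF (without r)
  WF-without r = WF-induced (G ∖ S) _ (WF-induced G _ wfG)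

  ∈-without⁺ : ∀ {x} r → x ∈ V G → S x ≡ false → x ∈ᵇ r ≡ false → x ∈ V (without r)
  ∈-without⁺ r x∈G Sx x∉r = ∈-filterᵇ⁺ _ (∈-filterᵇ⁺ _ x∈G (cong not Sx)) (cong not x∉r)

  ∈-without⁻ : ∀ {x} r → x ∈ V (without r) → x ∈ V G × S x ≡ false × x ∈ᵇ r ≡ false
  ∈-without⁻ r x∈ with ∈-filterᵇ⁻ _ {xs = V (G ∖ S)} x∈
  ... | x∈G∖S , x∉r with ∈-filterᵇ⁻ _ {xs = V G} x∈G∖S
  ...   | x∈G , Sx = x∈G , not-true⇒false Sx , not-true⇒false x∉r

  without⊆G∖S : ∀ {x} r → x ∈ V (without r) → x ∈ V (G ∖ S)
  without⊆G∖S r x∈ = proj₁ (∈-filterᵇ⁻ _ {xs = V (G ∖ S)} x∈)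

  Adj-without⁺ : ∀ {a b} r → a ∈ V (without r) → b ∈ V (without r) → Adj G a b → Adj (without r) a b
  Adj-without⁺ r a∈ b∈ a~b =
    Adj-induced⁺ (G ∖ S) _ a∈ b∈ (Adj-induced⁺ G _ (without⊆G∖S r a∈) (without⊆G∖S r b∈) a~b)

  Adj-without⁻ : ∀ {a b} r → a ∈ V (without r) → b ∈ V (without r) → Adj (without r) a b → Adj G a b
  Adj-without⁻ r a∈ b∈ a~b =
    Adj-induced⁻ G _ (without⊆G∖S r a∈) (without⊆G∖S r b∈) (Adj-induced⁻ (G ∖ S) _ a∈ b∈ a~b)

  ∈xs⁻ : ∀ {x} → x ∈ xs → x ∈ V G × X x ≡ true
  ∈xs⁻ = ∈-filterᵇ⁻ X {xs = V G}

  X-avoids-S-v : ∀ {x} → X x ≡ true → S x ≡ false × x ≢ v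
  X-avoids-S-v {x} Xx with not-∨-true (S x) (x ≡ᵇ v) (X-avoids x (X⊆V x Xx) Xx)
  ... | Sx , x≢v = Sx , ≡ᵇ-false⇒≢ x≢v

  Xv : X v ≡ false
  Xv with X v in Xv
  ... | false = refl
  ... | true  = ⊥-elim (proj₂ (X-avoids-S-v Xv) refl)

  ∈ᵇxs : ∀ x → x ∈ᵇ xs ≡ X x
  ∈ᵇxs x with X x in Xx
  ... | true  = dec-true (x ∈? xs) (∈-filterᵇ⁺ X (X⊆V x Xx) Xx)
  ... | false = dec-false (x ∈? xs) (λ x∈ → not-¬ Xx (proj₂ (∈xs⁻ x∈)))

  X-Adj : ∀ {a b} → X a ≡ true → X b ≡ true → a ≢ b → Adj G a b
  X-Adj {a} {b} Xa Xb = clique a b (X⊆V a Xa) (X⊆V b Xb) (cong (_∨ (a ≡ᵇ v)) Xa) (cong (_∨ (b ≡ᵇ v)) Xb)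

  X-Adj-v : ∀ {x} → X x ≡ true → Adj G x v
  X-Adj-v {x} Xx = clique x v (X⊆V x Xx) v∈G (cong (_∨ (x ≡ᵇ v)) Xx) v-in (proj₂ (X-avoids-S-v Xx))
    where
    v-in : X v ∨ (v ≡ᵇ v) ≡ true
    v-in rewrite ≡ᵇ-refl v = ∨-zeroʳ (X v)

  X-closed : ∀ {x w} → X x ≡ true → w ∈ V G → S w ≡ false → w ≢ v → Adj G x w → X w ≡ true
  X-closed {x} {w} Xx w∈G Sw w≢v x~w =
    IsComponent-closed (G ∖ (λ y → S y ∨ (y ≡ᵇ v))) X component x∈ Xx w∈ (Adj-induced⁺ G _ x∈ w∈ x~w)
    where
    x∈ : x ∈ V (G ∖ (λ y → S y ∨ (y ≡ᵇ v)))
    x∈ = ∈-filterᵇ⁺ _ (X⊆V x Xx) (X-avoids x (X⊆V x Xx) Xx)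
    w-avoids : not (S w ∨ (w ≡ᵇ v)) ≡ true
    w-avoids rewrite Sw | ≢⇒≡ᵇ-false w≢v = refl
    w∈ : w ∈ V (G ∖ (λ y → S y ∨ (y ≡ᵇ v)))
    w∈ = ∈-filterᵇ⁺ _ w∈G w-avoids

  start : GoodSpanning lam Π ((G ∖ X) ∖ S) k → GoodSpanning lam Π (without xs) k
  start = GoodSpanning-cong SE (WF-induced (G ∖ X) _ (WF-induced G _ wfG))
    (≈ᴳ-trans (≈ᴳ-sym (∖-∨ G X S))
    (≈ᴳ-trans (∖-cong G (λ x → trans (∨-comm (S x) (X x)) (cong (_∨ S x) (sym (∈ᵇxs x)))))
              (∖-∨ G S (_∈ᵇ xs))))

  finish : GoodSpanning lam Π (without []) k → GoodSpanning lam Π (G ∖ S) k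
  finish = GoodSpanning-cong SE (WF-without []) (∖-∅ (G ∖ S))

  addPair : ∀ {a b} r → a ∈ xs → b ∈ xs → a ≢ b → All (a ≢_) r → All (b ≢_) r →
            GoodSpanning lam Π (without (a ∷ b ∷ r)) k → GoodSpanning lam Π (without r) k
  addPair {a} {b} r a∈xs b∈xs a≢b a∉r b∉r =
    GoodSpanning-addK₂ SE (without r) (WF-without r) a∈ b∈ a≢b
      (Adj-without⁺ r a∈ b∈ (X-Adj (proj₂ (∈xs⁻ a∈xs)) (proj₂ (∈xs⁻ b∈xs)) a≢b))
    ∘ GoodSpanning-cong SE (WF-without (a ∷ b ∷ r))
        (≈ᴳ-trans (∖-cong (G ∖ S) (λ x → sym (∨-assoc (x ≡ᵇ a) (x ≡ᵇ b) (x ∈ᵇ r))))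
                  (∖-∨ (G ∖ S) (_∈ᵇ r) (pairᵇ a b)))
    where
    in-without : ∀ {x} → x ∈ xs → All (x ≢_) r → x ∈ V (without r)
    in-without x∈xs x∉r with ∈xs⁻ x∈xs
    ... | x∈G , Xx = ∈-without⁺ r x∈G (proj₁ (X-avoids-S-v Xx)) (∉⇒∈ᵇ-false x∉r)
    a∈ : a ∈ V (without r)
    a∈ = in-without a∈xs a∉r
    b∈ : b ∈ V (without r)
    b∈ = in-without b∈xs b∉r

  -- Once the rest of X is removed, its first vertex hangs off v alone.
  addPendant : ∀ {x} r → xs ≡ x ∷ r →
               GoodSpanning lam Π (without (x ∷ r)) k → GoodSpanning lam Π (without r) k
  addPendant {x} r xs≡ =
    GoodSpanning-addPendant SE 0<lam lam<1 (without r) (WF-without r) x∈ v∈ x≢v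
      (Adj-without⁺ r x∈ v∈ (X-Adj-v Xx)) only-v
    ∘ GoodSpanning-cong SE (WF-without (x ∷ r)) (∖-∨ (G ∖ S) (_∈ᵇ r) (_≡ᵇ x))
    where
    x∈xs : x ∈ xs
    x∈xs = subst (x ∈_) (sym xs≡) (here refl)
    Xx : X x ≡ true
    Xx = proj₂ (∈xs⁻ x∈xs)
    x≢v : x ≢ v
    x≢v = proj₂ (X-avoids-S-v Xx)
    x∉r : All (x ≢_) r
    x∉r with subst Unique xs≡ xs-unique
    ... | x∉r ∷ _ = x∉r
    x∈ : x ∈ V (without r)
    x∈ = ∈-without⁺ r (X⊆V x Xx) (proj₁ (X-avoids-S-v Xx)) (∉⇒∈ᵇ-false x∉r)
    v∉r : v ∈ᵇ r ≡ false
    v∉r = dec-false (v ∈? r) (λ v∈r → not-¬ Xv (proj₂ (∈xs⁻ (subst (v ∈_) (sym xs≡) (there v∈r)))))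
    v∈ : v ∈ V (without r)
    v∈ = ∈-without⁺ r v∈G Sv v∉r
    only-v : ∀ w → w ∈ V (without r) → Adj (without r) x w → w ≡ v
    only-v w w∈ x~w with w ≟ v | ∈-without⁻ r w∈
    ... | yes w≡v | _                 = w≡v
    ... | no  w≢v | w∈G , Sw , w∉r
      with subst (w ∈_) xs≡ (∈-filterᵇ⁺ X w∈G (X-closed Xx w∈G Sw w≢v (Adj-without⁻ r x∈ w∈ x~w)))
    ...   | here refl = ⊥-elim (WF-Adj-irrefl wfG (Adj-without⁻ r x∈ w∈ x~w))
    ...   | there w∈r with () ← trans (sym (dec-true (w ∈? r) w∈r)) w∉r

  addPairs : ∀ r → EvenLength r → All (_∈ xs) r → Unique r →
             GoodSpanning lam Π (without r) k → GoodSpanning lam Π (without []) k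
  addPairs []          nil          _                    _                                = id
  addPairs (a ∷ b ∷ r) (cons₂ even) (a∈xs ∷ b∈xs ∷ r⊆xs) ((a≢b ∷ a∉r) ∷ b∉r ∷ unique) =
    addPairs r even r⊆xs unique ∘ addPair r a∈xs b∈xs a≢b a∉r b∉r

  safe : GoodSpanning lam Π ((G ∖ X) ∖ S) k → GoodSpanning lam Π (G ∖ S) k
  safe = finish ∘ addAll (evenLength-or-cons xs) ∘ start
    where
    addAll : (EvenLength xs ⊎ Σ ℕ λ x → Σ (List ℕ) λ r → xs ≡ x ∷ r × EvenLength r) →
             GoodSpanning lam Π (without xs) k → GoodSpanning lam Π (without []) k
    addAll (inj₁ even) = addPairs xs even (All.tabulate id) xs-unique
    addAll (inj₂ (x , r , xs≡ , even)) =
      addPairs r even r⊆xs r-unique ∘ addPendant r xs≡ ∘ subst (λ ys → GoodSpanning lam Π (without ys) k) xs≡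
      where
      r⊆xs : All (_∈ xs) r
      r⊆xs = All.tabulate (λ y∈r → subst (_ ∈_) (sym xs≡) (there y∈r))
      r-unique : Unique r
      r-unique with subst Unique xs≡ xs-unique
      ... | _ ∷ unique = unique

mainTheorem6 : (L : Set) (lam : ℚ) → 0ℚ < lam → lam < 1ℚ →
               (Π : Graph L → Set) → StronglyExtendible lam Π →
               (G : Graph L) → WF G → (S : ℕ → Bool) → (k : ℚ) →
               (v : ℕ) (X : ℕ → Bool) → Rule1Applies G S v X →
               -- (G', S', k') = (G ∖ X, S, k)
               GoodSpanning lam Π ((G ∖ X) ∖ S) k →
               GoodSpanning lam Π (G ∖ S) k
mainTheorem6 L lam 0<lam lam<1 Π SE G wfG S k v X (_ , v∈G , Sv , X-avoids , X⊆V , component , clique) =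
  Rule1.safe 0<lam lam<1 SE G wfG S v X v∈G Sv X-avoids X⊆V component clique
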